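{- For every positive integer $m$, $f(4m,1)=16m+4$.
   Context: For positive integers $s,t$, a homothetic copy of $\{1,1+s,1+s+t\}$ is any set of the form $\{x,\,x+ys,\,x+ys+yt\}$ with $x,y$ positive integers. $f(s,t)$ denotes the smallest positive integer $N$ such that every 2-coloring of $[1,N]=\{1,\dots,N\}$ contains a monochromatic homothetic copy of $\{1,1+s,1+s+t\}$. -}

module Defs where

open import Data.Nat using (ℕ; _+_; _*_; _≤_; _<_)
open import Data.Bool using (Bool)
open import Data.Product using (Σ; _×_; ∃-syntax)
open import Relation.Binary.PropositionalEquality using (_≡_)
open import Relation.Nullary using (¬_)

-- A 2-coloring of [1,N]; values outside [1,N] are irrelevant.
Coloring : Set
Coloring = ℕ → Bool

-- c contains a monochromatic homothetic copy {x, x+ys, x+ys+yt} of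
-- {1,1+s,1+s+t} inside [1,N], with x,y positive integers.
MonoCopy : ℕ → ℕ → ℕ → Coloring → Set
MonoCopy N s t c =
  ∃[ x ] ∃[ y ] (1 ≤ x × 1 ≤ y × x + y * s + y * t ≤ N
                 × c x ≡ c (x + y * s) × c x ≡ c (x + y * s + y * t))

Arrows : ℕ → ℕ → ℕ → Set
Arrows N s t = (c : Coloring) → MonoCopy N s t c

IsF : ℕ → ℕ → ℕ → Set
IsF s t N = 1 ≤ N × Arrows N s t × ((M : ℕ) → 1 ≤ M → M < N → ¬ Arrows M s t)

module Submission where

open import Defs
open import Data.Bool using (Bool; true; false; T; not; if_then_else_; _∧_; _∨_; _xor_)
open import Data.Bool.Properties using (T-∧; T-∨; xor-assoc; xor-same; xor-identityʳ) renaming (_≟_ to _≟ᵇ_)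
open import Data.Empty using (⊥; ⊥-elim)
open import Data.List using (List; []; _∷_; map)
import Data.List.Properties as List
open import Data.List.Membership.Propositional using (_∈_)
open import Data.List.Relation.Unary.All using (All; []; _∷_; all?)
import Data.List.Relation.Unary.All as All
open import Data.List.Relation.Unary.Any using (any?)
open import Data.Maybe using (Maybe; just; nothing; zipWith)
open import Data.Maybe.Properties using (just-injective)
open import Data.Nat
  using (ℕ; zero; suc; _+_; _*_; _∸_; _%_; _/_; _≤_; _<_; _≤ᵇ_; _<ᵇ_; _≡ᵇ_; _≤?_; _<?_; z≤n; s≤s; NonZero; >-nonZero)
open import Data.Nat.Properties
open import Data.Nat.DivMod
  using (%-distribˡ-+; [m+kn]%n≡m%n; m<n⇒m%n≡m; +-distrib-/-∣ʳ; m<n⇒m/n≡0; m*n/n≡m; m≡m%n+[m/n]*n; m%n<n)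
open import Data.Nat.Divisibility using (_∣_; n∣m*n; m∣m*n; n∣m⇒m%n≡0)
open import Data.Nat.Tactic.RingSolver using (solve-∀)
open import Data.Product using (_×_; _,_; proj₁; proj₂; ∃-syntax)
open import Data.Product.Properties using (≡-dec)
open import Data.Sum using (inj₁; inj₂)
open import Function using (_∘_; Equivalence)
open import Relation.Binary using (Decidable)
open import Relation.Binary.PropositionalEquality
  using (_≡_; refl; sym; trans; cong; cong₂; subst; subst₂; module ≡-Reasoning)
open import Relation.Nullary using (¬_; Dec; yes; no; does)
open import Relation.Nullary.Decidable
  using (_×-dec_; _→-dec_; ¬?; map′; toWitness; isYes; decidable-stable)

open ≡-Reasoning

-- Read [1, N] as a grid with L columns, position 1 + r + q L being column r of row q.  A copy
-- {x, x + y L, x + y L + y} is then a corner: two cells y rows apart in one column and the cell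
-- y columns to the right of the lower one, wrapping to the next row past the right edge.
--
-- Lower bound (L even, L ≥ 4): colour row q by a fixed pattern of the distance to the right edge
-- (the short row 4 by the distance to the left edge), twisted by the parity of the column.  A
-- corner inside [1, 4L + 3] has y ≤ 3, so it has one of finitely many shapes, each checked directly.
--
-- Upper bound (4 ∣ L): take a colouring of [1, 4L + 4] without monochromatic corners and call
-- the colours of five fixed cells of the window at column x the state at x.  Decision trees over
-- the colourings of small windows, checked by evaluation, show that the states at x and x + 1
-- are related by a fixed transition relation, and that the triple (five colours at the start,
-- (x - 1) mod 4, state at x) lies in a fixed set at x = 1.  That set is closed under transitions,
-- so it contains the triple at x = L + 1, whose second entry is 0 because 4 ∣ L; a third decision
-- tree shows that the window at the end rules this out.

Monochromatic : Bool → Bool → Bool → Set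
Monochromatic a b c = a ≡ b × a ≡ c

monochromatic? : ∀ a b c → Dec (Monochromatic a b c)
monochromatic? a b c = (a ≟ᵇ b) ×-dec (a ≟ᵇ c)

monoCopy? : ∀ N s t .{{_ : NonZero t}} (c : Coloring) → Dec (MonoCopy N s t c)
monoCopy? N s t c = map′ forget bound (anyUpTo? (λ x → anyUpTo? (λ y → copy? x y) (suc N)) (suc N))
  where
  Copy : ℕ → ℕ → Set
  Copy x y = 1 ≤ x × 1 ≤ y × x + y * s + y * t ≤ N
             × Monochromatic (c x) (c (x + y * s)) (c (x + y * s + y * t))
  copy? : ∀ x y → Dec (Copy x y)
  copy? x y = (1 ≤? x) ×-dec (1 ≤? y) ×-dec (x + y * s + y * t ≤? N)
              ×-dec monochromatic? (c x) (c (x + y * s)) (c (x + y * s + y * t))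
  forget : (∃[ x ] x < suc N × ∃[ y ] y < suc N × Copy x y) → MonoCopy N s t c
  forget (x , _ , y , _ , copy) = x , y , copy
  bound : MonoCopy N s t c → ∃[ x ] x < suc N × ∃[ y ] y < suc N × Copy x y
  bound (x , y , copy@(_ , _ , fits , _)) =
    x , s≤s (≤-trans (≤-trans (m≤m+n x _) (m≤m+n _ _)) fits) ,
    y , s≤s (≤-trans (≤-trans (m≤m*n y t) (m≤n+m _ _)) fits) , copy

Arrows-mono : ∀ {M N s t} → M ≤ N → Arrows M s t → Arrows N s t
Arrows-mono M≤N arrows c with arrows c
... | x , y , 1≤x , 1≤y , fits , same = x , y , 1≤x , 1≤y , ≤-trans fits M≤N , same

map-∘-≗ : ∀ {A B C : Set} {f : B → C} {g : A → B} {h : A → C} → (∀ v → f (g v) ≡ h v) →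
          ∀ xs → map f (map g xs) ≡ map h xs
map-∘-≗ fg≗h xs = trans (sym (List.map-∘ xs)) (List.map-cong fg≗h xs)

-- Certified case analysis on the colourings of a window

-- (k , j) is the cell k rows below and j columns to the right of the origin of a window.
Cell : Set
Cell = ℕ × ℕ

_≟ᶜ_ : (u v : Cell) → Dec (u ≡ v)
_≟ᶜ_ = ≡-dec _≟_ _≟_

CornerFree : (Cell → Bool) → ℕ → ℕ → Set
CornerFree ρ K J = ∀ {y k j} → 1 ≤ y → k + y ≤ K → j + y ≤ J →
                   ¬ Monochromatic (ρ (k , j)) (ρ (k + y , j)) (ρ (k + y , j + y))

Assignment : Set
Assignment = List (Cell × Bool)

Agrees : (Cell → Bool) → Assignment → Set
Agrees ρ = All (λ (v , b) → ρ v ≡ b)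

colourOf : Assignment → Cell → Maybe Bool
colourOf [] v = nothing
colourOf ((u , b) ∷ σ) v = if does (u ≟ᶜ v) then just b else colourOf σ v

coloursOf : Assignment → List Cell → Maybe (List Bool)
coloursOf σ [] = just []
coloursOf σ (v ∷ vs) = zipWith _∷_ (colourOf σ v) (coloursOf σ vs)

colourOf-sound : ∀ {ρ σ v b} → Agrees ρ σ → colourOf σ v ≡ just b → ρ v ≡ b
colourOf-sound {σ = (u , _) ∷ _} {v} (ρu≡b ∷ agrees) found with u ≟ᶜ v
... | yes refl = trans ρu≡b (just-injective found)
... | no _     = colourOf-sound agrees found

coloursOf-sound : ∀ {ρ σ} vs {bs} → Agrees ρ σ → coloursOf σ vs ≡ just bs → map ρ vs ≡ bs
coloursOf-sound [] agrees refl = refl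
coloursOf-sound {σ = σ} (v ∷ vs) agrees found with colourOf σ v in eqv | coloursOf σ vs in eqvs | found
... | just b | just bs | refl = cong₂ _∷_ (colourOf-sound agrees eqv) (coloursOf-sound vs agrees eqvs)

data Certificate : Set where
  split  : (k j : ℕ) → Certificate → Certificate → Certificate
  corner : (y k j : ℕ) → Certificate
  done   : Certificate

-- A certificate proves that the colours of the cells cs₁ and cs₂ are related by R in every
-- colouring of the window [0, K] × [0, J] without monochromatic corners.
module Certified (K J : ℕ) {R : List Bool → List Bool → Set} (R? : Decidable R) (cs₁ cs₂ : List Cell)
  where

  monochromaticIn : Maybe (List Bool) → Bool
  monochromaticIn (just (a ∷ b ∷ c ∷ [])) = isYes (monochromatic? a b c)
  monochromaticIn _ = false

  relatedIn : Maybe (List Bool) → Maybe (List Bool) → Bool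
  relatedIn (just bs₁) (just bs₂) = isYes (R? bs₁ bs₂)
  relatedIn _ _ = false

  check : Assignment → Certificate → Bool
  check σ (split k j t f) = check (((k , j) , false) ∷ σ) t ∧ check (((k , j) , true) ∷ σ) f
  check σ (corner y k j) = (1 ≤ᵇ y) ∧ (k + y ≤ᵇ K) ∧ (j + y ≤ᵇ J)
                           ∧ monochromaticIn (coloursOf σ ((k , j) ∷ (k + y , j) ∷ (k + y , j + y) ∷ []))
  check σ done = relatedIn (coloursOf σ cs₁) (coloursOf σ cs₂)

  monochromaticIn-sound : ∀ {ρ σ} u v w → Agrees ρ σ →
                          T (monochromaticIn (coloursOf σ (u ∷ v ∷ w ∷ []))) → Monochromatic (ρ u) (ρ v) (ρ w)
  monochromaticIn-sound {σ = σ} u v w agrees mono with coloursOf σ (u ∷ v ∷ w ∷ []) in found | mono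
  ... | just (a ∷ b ∷ c ∷ []) | isMono with coloursOf-sound (u ∷ v ∷ w ∷ []) agrees found
  ...   | refl = toWitness isMono

  relatedIn-sound : ∀ {ρ σ} → Agrees ρ σ → T (relatedIn (coloursOf σ cs₁) (coloursOf σ cs₂)) →
                    R (map ρ cs₁) (map ρ cs₂)
  relatedIn-sound {σ = σ} agrees related
    with coloursOf σ cs₁ in found₁ | coloursOf σ cs₂ in found₂ | related
  ... | just bs₁ | just bs₂ | isRelated
    rewrite coloursOf-sound cs₁ agrees found₁ | coloursOf-sound cs₂ agrees found₂
    = toWitness isRelated

  check-sound : ∀ {ρ} σ t → CornerFree ρ K J → Agrees ρ σ → T (check σ t) →
                R (map ρ cs₁) (map ρ cs₂)
  check-sound {ρ} σ (split k j t f) free agrees ok with ρ (k , j) in eq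
  ... | false = check-sound _ t free (eq ∷ agrees) (proj₁ (Equivalence.to T-∧ ok))
  ... | true  = check-sound _ f free (eq ∷ agrees) (proj₂ (Equivalence.to T-∧ ok))
  check-sound σ (corner y k j) free agrees ok with Equivalence.to (T-∧ {1 ≤ᵇ y}) ok
  ... | 1≤y , rest with Equivalence.to (T-∧ {k + y ≤ᵇ K}) rest
  ... | k+y≤K , rest′ with Equivalence.to (T-∧ {j + y ≤ᵇ J}) rest′
  ... | j+y≤J , mono = ⊥-elim (free (≤ᵇ⇒≤ 1 y 1≤y) (≤ᵇ⇒≤ _ K k+y≤K) (≤ᵇ⇒≤ _ J j+y≤J)
                                     (monochromaticIn-sound _ _ _ agrees mono))
  check-sound σ done free agrees ok = relatedIn-sound agrees ok

  certified : ∀ {ρ} t → T (check [] t) → CornerFree ρ K J → R (map ρ cs₁) (map ρ cs₂)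
  certified t ok free = check-sound [] t free [] ok

-- Upper bound

_≟ˢ_ : (a b : List Bool) → Dec (a ≡ b)
_≟ˢ_ = List.≡-dec _≟ᵇ_

-- The two tables and the three certificates that follow were found by computer search.
transitions : List (List Bool × List Bool)
transitions =
  ((false ∷ false ∷ true ∷ false ∷ true ∷ []) , (false ∷ true ∷ false ∷ true ∷ true ∷ []))
  ∷ ((false ∷ false ∷ true ∷ true ∷ false ∷ []) , (false ∷ true ∷ true ∷ false ∷ false ∷ []))
  ∷ ((false ∷ true ∷ false ∷ false ∷ true ∷ []) , (true ∷ false ∷ false ∷ true ∷ false ∷ []))
  ∷ ((false ∷ true ∷ false ∷ false ∷ true ∷ []) , (true ∷ false ∷ false ∷ true ∷ true ∷ []))
  ∷ ((false ∷ true ∷ false ∷ false ∷ true ∷ []) , (true ∷ false ∷ true ∷ true ∷ false ∷ []))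
  ∷ ((false ∷ true ∷ false ∷ true ∷ true ∷ []) , (true ∷ false ∷ false ∷ true ∷ false ∷ []))
  ∷ ((false ∷ true ∷ false ∷ true ∷ true ∷ []) , (true ∷ true ∷ false ∷ true ∷ false ∷ []))
  ∷ ((false ∷ true ∷ true ∷ false ∷ false ∷ []) , (true ∷ true ∷ false ∷ false ∷ true ∷ []))
  ∷ ((false ∷ true ∷ true ∷ false ∷ true ∷ []) , (true ∷ false ∷ false ∷ true ∷ false ∷ []))
  ∷ ((true ∷ false ∷ false ∷ true ∷ false ∷ []) , (false ∷ true ∷ true ∷ false ∷ true ∷ []))
  ∷ ((true ∷ false ∷ false ∷ true ∷ true ∷ []) , (false ∷ false ∷ true ∷ true ∷ false ∷ []))
  ∷ ((true ∷ false ∷ true ∷ false ∷ false ∷ []) , (false ∷ false ∷ true ∷ false ∷ true ∷ []))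
  ∷ ((true ∷ false ∷ true ∷ false ∷ false ∷ []) , (false ∷ true ∷ true ∷ false ∷ true ∷ []))
  ∷ ((true ∷ false ∷ true ∷ true ∷ false ∷ []) , (false ∷ true ∷ false ∷ false ∷ true ∷ []))
  ∷ ((true ∷ false ∷ true ∷ true ∷ false ∷ []) , (false ∷ true ∷ true ∷ false ∷ false ∷ []))
  ∷ ((true ∷ false ∷ true ∷ true ∷ false ∷ []) , (false ∷ true ∷ true ∷ false ∷ true ∷ []))
  ∷ ((true ∷ true ∷ false ∷ false ∷ true ∷ []) , (true ∷ false ∷ false ∷ true ∷ true ∷ []))
  ∷ ((true ∷ true ∷ false ∷ true ∷ false ∷ []) , (true ∷ false ∷ true ∷ false ∷ false ∷ []))
  ∷ []

Transition : List Bool → List Bool → Set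
Transition a b = (a , b) ∈ transitions

transition? : Decidable Transition
transition? a b = any? (≡-dec _≟ˢ_ _≟ˢ_ (a , b)) transitions

reachable : List (List Bool × ℕ × List Bool)
reachable =
  ((false ∷ false ∷ false ∷ true ∷ false ∷ []) , 0 , (false ∷ false ∷ true ∷ true ∷ false ∷ []))
  ∷ ((false ∷ false ∷ false ∷ true ∷ false ∷ []) , 1 , (false ∷ true ∷ true ∷ false ∷ false ∷ []))
  ∷ ((false ∷ false ∷ false ∷ true ∷ false ∷ []) , 2 , (true ∷ true ∷ false ∷ false ∷ true ∷ []))
  ∷ ((false ∷ false ∷ false ∷ true ∷ false ∷ []) , 3 , (true ∷ false ∷ false ∷ true ∷ true ∷ []))
  ∷ ((false ∷ false ∷ true ∷ false ∷ true ∷ []) , 0 , (false ∷ true ∷ true ∷ false ∷ true ∷ []))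
  ∷ ((false ∷ false ∷ true ∷ false ∷ true ∷ []) , 1 , (true ∷ false ∷ false ∷ true ∷ false ∷ []))
  ∷ ((false ∷ false ∷ true ∷ false ∷ true ∷ []) , 2 , (false ∷ true ∷ true ∷ false ∷ true ∷ []))
  ∷ ((false ∷ false ∷ true ∷ false ∷ true ∷ []) , 3 , (true ∷ false ∷ false ∷ true ∷ false ∷ []))
  ∷ ((false ∷ true ∷ false ∷ false ∷ true ∷ []) , 0 , (false ∷ false ∷ true ∷ false ∷ true ∷ []))
  ∷ ((false ∷ true ∷ false ∷ false ∷ true ∷ []) , 0 , (false ∷ true ∷ true ∷ false ∷ true ∷ []))
  ∷ ((false ∷ true ∷ false ∷ false ∷ true ∷ []) , 0 , (true ∷ false ∷ false ∷ true ∷ false ∷ []))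
  ∷ ((false ∷ true ∷ false ∷ false ∷ true ∷ []) , 1 , (false ∷ true ∷ false ∷ true ∷ true ∷ []))
  ∷ ((false ∷ true ∷ false ∷ false ∷ true ∷ []) , 1 , (false ∷ true ∷ true ∷ false ∷ true ∷ []))
  ∷ ((false ∷ true ∷ false ∷ false ∷ true ∷ []) , 1 , (true ∷ false ∷ false ∷ true ∷ false ∷ []))
  ∷ ((false ∷ true ∷ false ∷ false ∷ true ∷ []) , 2 , (false ∷ true ∷ true ∷ false ∷ true ∷ []))
  ∷ ((false ∷ true ∷ false ∷ false ∷ true ∷ []) , 2 , (true ∷ false ∷ false ∷ true ∷ false ∷ []))
  ∷ ((false ∷ true ∷ false ∷ false ∷ true ∷ []) , 2 , (true ∷ true ∷ false ∷ true ∷ false ∷ []))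
  ∷ ((false ∷ true ∷ false ∷ false ∷ true ∷ []) , 3 , (false ∷ true ∷ true ∷ false ∷ true ∷ []))
  ∷ ((false ∷ true ∷ false ∷ false ∷ true ∷ []) , 3 , (true ∷ false ∷ false ∷ true ∷ false ∷ []))
  ∷ ((false ∷ true ∷ false ∷ false ∷ true ∷ []) , 3 , (true ∷ false ∷ true ∷ false ∷ false ∷ []))
  ∷ ((false ∷ true ∷ true ∷ false ∷ false ∷ []) , 0 , (false ∷ true ∷ true ∷ false ∷ false ∷ []))
  ∷ ((false ∷ true ∷ true ∷ false ∷ false ∷ []) , 1 , (true ∷ true ∷ false ∷ false ∷ true ∷ []))
  ∷ ((false ∷ true ∷ true ∷ false ∷ false ∷ []) , 2 , (true ∷ false ∷ false ∷ true ∷ true ∷ []))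
  ∷ ((false ∷ true ∷ true ∷ false ∷ false ∷ []) , 3 , (false ∷ false ∷ true ∷ true ∷ false ∷ []))
  ∷ ((false ∷ true ∷ true ∷ false ∷ true ∷ []) , 0 , (false ∷ false ∷ true ∷ true ∷ false ∷ []))
  ∷ ((false ∷ true ∷ true ∷ false ∷ true ∷ []) , 0 , (false ∷ true ∷ false ∷ false ∷ true ∷ []))
  ∷ ((false ∷ true ∷ true ∷ false ∷ true ∷ []) , 0 , (false ∷ true ∷ true ∷ false ∷ false ∷ []))
  ∷ ((false ∷ true ∷ true ∷ false ∷ true ∷ []) , 0 , (false ∷ true ∷ true ∷ false ∷ true ∷ []))
  ∷ ((false ∷ true ∷ true ∷ false ∷ true ∷ []) , 0 , (true ∷ false ∷ false ∷ true ∷ true ∷ []))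
  ∷ ((false ∷ true ∷ true ∷ false ∷ true ∷ []) , 0 , (true ∷ true ∷ false ∷ false ∷ true ∷ []))
  ∷ ((false ∷ true ∷ true ∷ false ∷ true ∷ []) , 1 , (false ∷ false ∷ true ∷ true ∷ false ∷ []))
  ∷ ((false ∷ true ∷ true ∷ false ∷ true ∷ []) , 1 , (false ∷ true ∷ true ∷ false ∷ false ∷ []))
  ∷ ((false ∷ true ∷ true ∷ false ∷ true ∷ []) , 1 , (true ∷ false ∷ false ∷ true ∷ false ∷ []))
  ∷ ((false ∷ true ∷ true ∷ false ∷ true ∷ []) , 1 , (true ∷ false ∷ false ∷ true ∷ true ∷ []))
  ∷ ((false ∷ true ∷ true ∷ false ∷ true ∷ []) , 1 , (true ∷ false ∷ true ∷ true ∷ false ∷ []))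
  ∷ ((false ∷ true ∷ true ∷ false ∷ true ∷ []) , 1 , (true ∷ true ∷ false ∷ false ∷ true ∷ []))
  ∷ ((false ∷ true ∷ true ∷ false ∷ true ∷ []) , 2 , (false ∷ false ∷ true ∷ true ∷ false ∷ []))
  ∷ ((false ∷ true ∷ true ∷ false ∷ true ∷ []) , 2 , (false ∷ true ∷ false ∷ false ∷ true ∷ []))
  ∷ ((false ∷ true ∷ true ∷ false ∷ true ∷ []) , 2 , (false ∷ true ∷ true ∷ false ∷ false ∷ []))
  ∷ ((false ∷ true ∷ true ∷ false ∷ true ∷ []) , 2 , (false ∷ true ∷ true ∷ false ∷ true ∷ []))
  ∷ ((false ∷ true ∷ true ∷ false ∷ true ∷ []) , 2 , (true ∷ false ∷ false ∷ true ∷ true ∷ []))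
  ∷ ((false ∷ true ∷ true ∷ false ∷ true ∷ []) , 2 , (true ∷ true ∷ false ∷ false ∷ true ∷ []))
  ∷ ((false ∷ true ∷ true ∷ false ∷ true ∷ []) , 3 , (false ∷ false ∷ true ∷ true ∷ false ∷ []))
  ∷ ((false ∷ true ∷ true ∷ false ∷ true ∷ []) , 3 , (false ∷ true ∷ true ∷ false ∷ false ∷ []))
  ∷ ((false ∷ true ∷ true ∷ false ∷ true ∷ []) , 3 , (true ∷ false ∷ false ∷ true ∷ false ∷ []))
  ∷ ((false ∷ true ∷ true ∷ false ∷ true ∷ []) , 3 , (true ∷ false ∷ false ∷ true ∷ true ∷ []))
  ∷ ((false ∷ true ∷ true ∷ false ∷ true ∷ []) , 3 , (true ∷ false ∷ true ∷ true ∷ false ∷ []))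
  ∷ ((false ∷ true ∷ true ∷ false ∷ true ∷ []) , 3 , (true ∷ true ∷ false ∷ false ∷ true ∷ []))
  ∷ ((false ∷ true ∷ true ∷ true ∷ true ∷ []) , 0 , (false ∷ true ∷ false ∷ true ∷ true ∷ []))
  ∷ ((false ∷ true ∷ true ∷ true ∷ true ∷ []) , 0 , (false ∷ true ∷ true ∷ false ∷ true ∷ []))
  ∷ ((false ∷ true ∷ true ∷ true ∷ true ∷ []) , 0 , (true ∷ false ∷ false ∷ true ∷ false ∷ []))
  ∷ ((false ∷ true ∷ true ∷ true ∷ true ∷ []) , 1 , (false ∷ true ∷ true ∷ false ∷ true ∷ []))
  ∷ ((false ∷ true ∷ true ∷ true ∷ true ∷ []) , 1 , (true ∷ false ∷ false ∷ true ∷ false ∷ []))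
  ∷ ((false ∷ true ∷ true ∷ true ∷ true ∷ []) , 1 , (true ∷ true ∷ false ∷ true ∷ false ∷ []))
  ∷ ((false ∷ true ∷ true ∷ true ∷ true ∷ []) , 2 , (false ∷ true ∷ true ∷ false ∷ true ∷ []))
  ∷ ((false ∷ true ∷ true ∷ true ∷ true ∷ []) , 2 , (true ∷ false ∷ false ∷ true ∷ false ∷ []))
  ∷ ((false ∷ true ∷ true ∷ true ∷ true ∷ []) , 2 , (true ∷ false ∷ true ∷ false ∷ false ∷ []))
  ∷ ((false ∷ true ∷ true ∷ true ∷ true ∷ []) , 3 , (false ∷ false ∷ true ∷ false ∷ true ∷ []))
  ∷ ((false ∷ true ∷ true ∷ true ∷ true ∷ []) , 3 , (false ∷ true ∷ true ∷ false ∷ true ∷ []))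
  ∷ ((false ∷ true ∷ true ∷ true ∷ true ∷ []) , 3 , (true ∷ false ∷ false ∷ true ∷ false ∷ []))
  ∷ ((true ∷ false ∷ false ∷ false ∷ false ∷ []) , 0 , (false ∷ true ∷ true ∷ false ∷ true ∷ []))
  ∷ ((true ∷ false ∷ false ∷ false ∷ false ∷ []) , 0 , (true ∷ false ∷ false ∷ true ∷ false ∷ []))
  ∷ ((true ∷ false ∷ false ∷ false ∷ false ∷ []) , 0 , (true ∷ false ∷ true ∷ false ∷ false ∷ []))
  ∷ ((true ∷ false ∷ false ∷ false ∷ false ∷ []) , 1 , (false ∷ false ∷ true ∷ false ∷ true ∷ []))
  ∷ ((true ∷ false ∷ false ∷ false ∷ false ∷ []) , 1 , (false ∷ true ∷ true ∷ false ∷ true ∷ []))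
  ∷ ((true ∷ false ∷ false ∷ false ∷ false ∷ []) , 1 , (true ∷ false ∷ false ∷ true ∷ false ∷ []))
  ∷ ((true ∷ false ∷ false ∷ false ∷ false ∷ []) , 2 , (false ∷ true ∷ false ∷ true ∷ true ∷ []))
  ∷ ((true ∷ false ∷ false ∷ false ∷ false ∷ []) , 2 , (false ∷ true ∷ true ∷ false ∷ true ∷ []))
  ∷ ((true ∷ false ∷ false ∷ false ∷ false ∷ []) , 2 , (true ∷ false ∷ false ∷ true ∷ false ∷ []))
  ∷ ((true ∷ false ∷ false ∷ false ∷ false ∷ []) , 3 , (false ∷ true ∷ true ∷ false ∷ true ∷ []))
  ∷ ((true ∷ false ∷ false ∷ false ∷ false ∷ []) , 3 , (true ∷ false ∷ false ∷ true ∷ false ∷ []))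
  ∷ ((true ∷ false ∷ false ∷ false ∷ false ∷ []) , 3 , (true ∷ true ∷ false ∷ true ∷ false ∷ []))
  ∷ ((true ∷ false ∷ false ∷ true ∷ false ∷ []) , 0 , (false ∷ false ∷ true ∷ true ∷ false ∷ []))
  ∷ ((true ∷ false ∷ false ∷ true ∷ false ∷ []) , 0 , (false ∷ true ∷ true ∷ false ∷ false ∷ []))
  ∷ ((true ∷ false ∷ false ∷ true ∷ false ∷ []) , 0 , (true ∷ false ∷ false ∷ true ∷ false ∷ []))
  ∷ ((true ∷ false ∷ false ∷ true ∷ false ∷ []) , 0 , (true ∷ false ∷ false ∷ true ∷ true ∷ []))
  ∷ ((true ∷ false ∷ false ∷ true ∷ false ∷ []) , 0 , (true ∷ false ∷ true ∷ true ∷ false ∷ []))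
  ∷ ((true ∷ false ∷ false ∷ true ∷ false ∷ []) , 0 , (true ∷ true ∷ false ∷ false ∷ true ∷ []))
  ∷ ((true ∷ false ∷ false ∷ true ∷ false ∷ []) , 1 , (false ∷ false ∷ true ∷ true ∷ false ∷ []))
  ∷ ((true ∷ false ∷ false ∷ true ∷ false ∷ []) , 1 , (false ∷ true ∷ false ∷ false ∷ true ∷ []))
  ∷ ((true ∷ false ∷ false ∷ true ∷ false ∷ []) , 1 , (false ∷ true ∷ true ∷ false ∷ false ∷ []))
  ∷ ((true ∷ false ∷ false ∷ true ∷ false ∷ []) , 1 , (false ∷ true ∷ true ∷ false ∷ true ∷ []))
  ∷ ((true ∷ false ∷ false ∷ true ∷ false ∷ []) , 1 , (true ∷ false ∷ false ∷ true ∷ true ∷ []))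
  ∷ ((true ∷ false ∷ false ∷ true ∷ false ∷ []) , 1 , (true ∷ true ∷ false ∷ false ∷ true ∷ []))
  ∷ ((true ∷ false ∷ false ∷ true ∷ false ∷ []) , 2 , (false ∷ false ∷ true ∷ true ∷ false ∷ []))
  ∷ ((true ∷ false ∷ false ∷ true ∷ false ∷ []) , 2 , (false ∷ true ∷ true ∷ false ∷ false ∷ []))
  ∷ ((true ∷ false ∷ false ∷ true ∷ false ∷ []) , 2 , (true ∷ false ∷ false ∷ true ∷ false ∷ []))
  ∷ ((true ∷ false ∷ false ∷ true ∷ false ∷ []) , 2 , (true ∷ false ∷ false ∷ true ∷ true ∷ []))
  ∷ ((true ∷ false ∷ false ∷ true ∷ false ∷ []) , 2 , (true ∷ false ∷ true ∷ true ∷ false ∷ []))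
  ∷ ((true ∷ false ∷ false ∷ true ∷ false ∷ []) , 2 , (true ∷ true ∷ false ∷ false ∷ true ∷ []))
  ∷ ((true ∷ false ∷ false ∷ true ∷ false ∷ []) , 3 , (false ∷ false ∷ true ∷ true ∷ false ∷ []))
  ∷ ((true ∷ false ∷ false ∷ true ∷ false ∷ []) , 3 , (false ∷ true ∷ false ∷ false ∷ true ∷ []))
  ∷ ((true ∷ false ∷ false ∷ true ∷ false ∷ []) , 3 , (false ∷ true ∷ true ∷ false ∷ false ∷ []))
  ∷ ((true ∷ false ∷ false ∷ true ∷ false ∷ []) , 3 , (false ∷ true ∷ true ∷ false ∷ true ∷ []))
  ∷ ((true ∷ false ∷ false ∷ true ∷ false ∷ []) , 3 , (true ∷ false ∷ false ∷ true ∷ true ∷ []))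
  ∷ ((true ∷ false ∷ false ∷ true ∷ false ∷ []) , 3 , (true ∷ true ∷ false ∷ false ∷ true ∷ []))
  ∷ ((true ∷ false ∷ false ∷ true ∷ true ∷ []) , 0 , (true ∷ false ∷ false ∷ true ∷ true ∷ []))
  ∷ ((true ∷ false ∷ false ∷ true ∷ true ∷ []) , 1 , (false ∷ false ∷ true ∷ true ∷ false ∷ []))
  ∷ ((true ∷ false ∷ false ∷ true ∷ true ∷ []) , 2 , (false ∷ true ∷ true ∷ false ∷ false ∷ []))
  ∷ ((true ∷ false ∷ false ∷ true ∷ true ∷ []) , 3 , (true ∷ true ∷ false ∷ false ∷ true ∷ []))
  ∷ ((true ∷ false ∷ true ∷ true ∷ false ∷ []) , 0 , (false ∷ true ∷ true ∷ false ∷ true ∷ []))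
  ∷ ((true ∷ false ∷ true ∷ true ∷ false ∷ []) , 0 , (true ∷ false ∷ false ∷ true ∷ false ∷ []))
  ∷ ((true ∷ false ∷ true ∷ true ∷ false ∷ []) , 0 , (true ∷ true ∷ false ∷ true ∷ false ∷ []))
  ∷ ((true ∷ false ∷ true ∷ true ∷ false ∷ []) , 1 , (false ∷ true ∷ true ∷ false ∷ true ∷ []))
  ∷ ((true ∷ false ∷ true ∷ true ∷ false ∷ []) , 1 , (true ∷ false ∷ false ∷ true ∷ false ∷ []))
  ∷ ((true ∷ false ∷ true ∷ true ∷ false ∷ []) , 1 , (true ∷ false ∷ true ∷ false ∷ false ∷ []))
  ∷ ((true ∷ false ∷ true ∷ true ∷ false ∷ []) , 2 , (false ∷ false ∷ true ∷ false ∷ true ∷ []))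
  ∷ ((true ∷ false ∷ true ∷ true ∷ false ∷ []) , 2 , (false ∷ true ∷ true ∷ false ∷ true ∷ []))
  ∷ ((true ∷ false ∷ true ∷ true ∷ false ∷ []) , 2 , (true ∷ false ∷ false ∷ true ∷ false ∷ []))
  ∷ ((true ∷ false ∷ true ∷ true ∷ false ∷ []) , 3 , (false ∷ true ∷ false ∷ true ∷ true ∷ []))
  ∷ ((true ∷ false ∷ true ∷ true ∷ false ∷ []) , 3 , (false ∷ true ∷ true ∷ false ∷ true ∷ []))
  ∷ ((true ∷ false ∷ true ∷ true ∷ false ∷ []) , 3 , (true ∷ false ∷ false ∷ true ∷ false ∷ []))
  ∷ ((true ∷ true ∷ false ∷ true ∷ false ∷ []) , 0 , (true ∷ false ∷ false ∷ true ∷ false ∷ []))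
  ∷ ((true ∷ true ∷ false ∷ true ∷ false ∷ []) , 1 , (false ∷ true ∷ true ∷ false ∷ true ∷ []))
  ∷ ((true ∷ true ∷ false ∷ true ∷ false ∷ []) , 2 , (true ∷ false ∷ false ∷ true ∷ false ∷ []))
  ∷ ((true ∷ true ∷ false ∷ true ∷ false ∷ []) , 3 , (false ∷ true ∷ true ∷ false ∷ true ∷ []))
  ∷ ((true ∷ true ∷ true ∷ false ∷ true ∷ []) , 0 , (true ∷ true ∷ false ∷ false ∷ true ∷ []))
  ∷ ((true ∷ true ∷ true ∷ false ∷ true ∷ []) , 1 , (true ∷ false ∷ false ∷ true ∷ true ∷ []))
  ∷ ((true ∷ true ∷ true ∷ false ∷ true ∷ []) , 2 , (false ∷ false ∷ true ∷ true ∷ false ∷ []))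
  ∷ ((true ∷ true ∷ true ∷ false ∷ true ∷ []) , 3 , (false ∷ true ∷ true ∷ false ∷ false ∷ []))
  ∷ []

Reachable : List Bool → ℕ → List Bool → Set
Reachable i p s = (i , p , s) ∈ reachable

reachable? : ∀ i p s → Dec (Reachable i p s)
reachable? i p s = any? (≡-dec _≟ˢ_ (≡-dec _≟_ _≟ˢ_) (i , p , s)) reachable

Closed : List Bool × ℕ × List Bool → Set
Closed (i , p , a) = All (λ (a′ , b) → a ≡ a′ → Reachable i (suc p % 4) b) transitions

closed? : ∀ e → Dec (Closed e)
closed? (i , p , a) = all? (λ (a′ , b) → (a ≟ˢ a′) →-dec reachable? i (suc p % 4) b) transitions

reachable-closed : All Closed reachable
reachable-closed = toWitness {a? = all? closed? reachable} _

reachable-step : ∀ {i p a b} → Reachable i p a → Transition a b → Reachable i (suc p % 4) b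
reachable-step r t = All.lookup (All.lookup reachable-closed r) t refl

stateCells : List Cell
stateCells = (1 , 0) ∷ (1 , 1) ∷ (2 , 1) ∷ (3 , 1) ∷ (3 , 2) ∷ []

startCells : List Cell
startCells = (1 , 0) ∷ (2 , 0) ∷ (1 , 1) ∷ (3 , 1) ∷ (3 , 2) ∷ []

rightOf : Cell → Cell
rightOf (k , j) = (k , suc j)

below : Cell → Cell
below (k , j) = (suc k , j)

stepCertificate : Certificate
stepCertificate =
  (split 1 0 (split 1 1 (split 0 0 (corner 1 0 0) (split 2 1 (split 2 0 (corner 1 1 0) (split 2 2 (corner 1 1 1) (corner 2 0 0))) (split 3 1 (split 3 3 (corner 2 1 1) (split 3 0 (split 2 0 (corner 1 2 0) (split 2 2 (split 3 2 (corner 2 1 0) (split 1 2 (split 0 1 (corner 1 0 1) (split 2 3 (corner 1 1 2) (corner 2 0 1))) done)) (corner 2 0 0))) (corner 3 0 0))) (split 3 2 (split 3 0 (corner 2 1 0) (split 2 0 (split 3 3 (split 2 2 (corner 1 2 2) (split 1 2 (split 0 1 (corner 1 0 1) (split 2 3 (split 3 4 (corner 1 2 3) (corner 3 0 1)) (corner 2 0 1))) done)) (corner 3 0 0)) (corner 1 2 0))) (corner 1 2 1))))) (split 2 1 (split 2 0 (corner 1 1 0) (split 3 1 (split 3 2 (corner 1 2 1) (split 1 2 (split 2 2 (split 2 3 (corner 1 1 2) (split 3 3 done done)) (split 3 3 done (corner 1 2 2))) (split 0 1 (split 2 3 (corner 2 0 1) (split 2 2 (split 3 4 (corner 3 0 1)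 (corner 2 1 2)) (corner 1 1 2))) (corner 1 0 1)))) (split 3 0 (split 3 2 (corner 2 1 0) (split 3 3 (split 0 0 (corner 3 0 0) (split 2 2 (split 1 2 done done) (corner 2 0 0))) (corner 2 1 1))) (corner 1 2 0)))) (split 2 2 (split 3 1 (split 3 2 (split 3 3 (corner 1 2 2) (split 3 0 (corner 2 1 0) (split 0 0 (split 2 0 (corner 2 0 0) (split 1 2 (split 2 3 (corner 1 1 2) (split 3 4 (corner 2 1 2) (corner 1 2 3))) done)) (corner 3 0 0)))) (split 1 2 (split 2 3 (corner 1 1 2) (split 0 1 (split 3 4 (corner 3 0 1) (split 3 3 done (corner 1 2 3))) (corner 2 0 1))) (split 0 1 (split 3 4 (corner 3 0 1) (corner 2 1 2)) (corner 1 0 1)))) (split 3 2 (split 3 3 (corner 1 2 2) (corner 2 1 1)) (corner 1 2 1))) (corner 1 1 1)))) (split 1 1 (split 2 1 (split 2 2 (corner 1 1 1) (split 3 1 (split 3 2 (corner 1 2 1) (split 3 3 (corner 2 1 1) (corner 1 2 2))) (split 3 2 (split 1 2 (split 0 1 (corner 1 0 1) (split 3 4 (corner 2 1 2) (corner 3 0 1))) (split 2 3 (split 0 1 (corner 2 0 1) (split 3 4 (split 3 3 (corner 1 2 3) done) (corner 3 0 1))) (corner 1 1 2))) (split 3 3 (split 3 0 (split 0 0 (corner 3 0 0) (split 2 0 (split 1 2 done (split 2 3 (split 3 4 (corner 1 2 3) (corner 2 1 2)) (corner 1 1 2))) (corner 2 0 0))) (corner 2 1 0)) (corner 1 2 2)))))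 (split 2 0 (split 3 1 (split 3 0 (corner 1 2 0) (split 3 2 (split 3 3 (corner 2 1 1) (split 0 0 (split 2 2 (corner 2 0 0) (split 1 2 done done)) (corner 3 0 0))) (corner 2 1 0))) (split 3 2 (split 1 2 (split 0 1 (corner 1 0 1) (split 2 3 (split 2 2 (corner 1 1 2) (split 3 4 (corner 2 1 2) (corner 3 0 1))) (corner 2 0 1))) (split 2 2 (split 3 3 (corner 1 2 2) done) (split 2 3 (split 3 3 done done) (corner 1 1 2)))) (corner 1 2 1))) (corner 1 1 0))) (split 0 0 (split 2 1 (split 3 1 (split 3 2 (corner 1 2 1) (split 3 0 (split 2 0 (corner 1 2 0) (split 3 3 (corner 3 0 0) (split 2 2 (split 1 2 done (split 0 1 (split 2 3 (corner 2 0 1) (split 3 4 (corner 3 0 1) (corner 1 2 3))) (corner 1 0 1))) (corner 1 2 2)))) (corner 2 1 0))) (split 3 3 (split 3 0 (corner 3 0 0) (split 2 0 (split 2 2 (corner 2 0 0) (split 3 2 (split 1 2 done (split 0 1 (split 2 3 (corner 2 0 1) (corner 1 1 2)) (corner 1 0 1))) (corner 2 1 0))) (corner 1 2 0))) (corner 2 1 1))) (split 2 0 (split 2 2 (corner 2 0 0) (corner 1 1 1)) (corner 1 1 0))) (corner 1 0 0))))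

baseCertificate : Certificate
baseCertificate =
  (split 1 0 (split 2 0 (split 2 1 (corner 1 1 0) (split 1 1 (split 0 0 (corner 1 0 0) (split 3 1 (split 3 0 (corner 1 2 0) (split 3 3 (corner 2 1 1) (corner 3 0 0))) (split 3 2 done (corner 1 2 1)))) (split 2 2 (split 0 0 (corner 2 0 0) (split 3 1 (split 3 0 (corner 1 2 0) (split 3 3 (split 3 2 (corner 1 2 2) done) (corner 3 0 0))) (split 3 2 (split 3 3 (corner 1 2 2) (corner 2 1 1)) (corner 1 2 1)))) (corner 1 1 1)))) (split 1 1 (split 0 0 (corner 1 0 0) (split 2 2 (split 2 1 (corner 1 1 1) (split 3 1 (split 3 3 (corner 2 1 1) (split 3 0 (split 3 2 (corner 2 1 0) done) (corner 3 0 0))) (split 3 0 (split 3 2 (corner 2 1 0) (corner 1 2 1)) (corner 1 2 0)))) (corner 2 0 0))) (split 3 1 (split 3 2 (split 2 1 (corner 1 2 1) done) (split 2 1 done done)) (split 3 0 (split 3 2 (corner 2 1 0) (split 2 1 done (corner 1 2 1))) (corner 1 2 0))))) (split 2 0 (split 1 1 (split 3 1 (split 3 0 (corner 1 2 0) (split 3 2 (split 2 1 (corner 1 2 1) done) (corner 2 1 0))) (split 3 2 (split 2 1 done done) (split 2 1 done (corner 1 2 1)))) (split 0 0 (split 2 2 (corner 2 0 0) (split 2 1 (split 3 1 (split 3 0 (corner 1 2 0) (split 3 2 (corner 1 2 1) (corner 2 1 0))) (split 3 3 (split 3 0 (corner 3 0 0) (split 3 2 done (corner 2 1 0))) (corner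 2 1 1))) (corner 1 1 1))) (corner 1 0 0))) (split 2 1 (split 1 1 (split 2 2 (corner 1 1 1) (split 0 0 (split 3 1 (split 3 2 (corner 1 2 1) (split 3 3 (corner 2 1 1) (corner 1 2 2))) (split 3 0 (split 3 3 (corner 3 0 0) (split 3 2 done (corner 1 2 2))) (corner 1 2 0))) (corner 2 0 0))) (split 0 0 (split 3 1 (split 3 2 (corner 1 2 1) done) (split 3 0 (split 3 3 (corner 3 0 0) (corner 2 1 1)) (corner 1 2 0))) (corner 1 0 0))) (corner 1 1 0))))

endCertificate : Certificate
endCertificate =
  (split 1 0 (split 2 0 (split 2 1 (corner 1 1 0) (split 1 1 (split 0 0 (corner 1 0 0) (split 3 1 (split 3 0 (corner 1 2 0) (split 3 3 (corner 2 1 1) (corner 3 0 0))) (split 3 2 (split 3 0 (corner 2 1 0) (split 3 3 (split 2 2 (corner 1 2 2) (split 4 1 (split 4 2 done done) (split 4 0 (split 4 2 (corner 2 2 0) (corner 1 3 1)) (corner 1 3 0)))) (corner 3 0 0))) (corner 1 2 1)))) (split 2 2 (split 0 0 (corner 2 0 0) (split 3 1 (split 3 0 (corner 1 2 0) (split 3 3 (split 3 2 (corner 1 2 2) (split 4 1 (split 4 2 (corner 1 3 1) done) (split 4 0 (split 4 2 (corner 2 2 0) done) (corner 1 3 0)))) (corner 3 0 0))) (split 3 2 (split 3 3 (corner 1 2 2) (corner 2 1 1)) (corner 1 2 1)))) (corner 1 1 1)))) (split 1 1 (split 0 0 (corner 1 0 0) (split 2 2 (split 2 1 (corner 1 1 1)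 (split 3 1 (split 3 3 (corner 2 1 1) (split 3 0 (split 3 2 (corner 2 1 0) (split 4 1 (split 4 0 (corner 1 3 0) (split 4 2 (corner 1 3 1) (corner 2 2 0))) (split 4 3 (split 4 0 (corner 3 1 0) (split 4 2 done (corner 2 2 0))) (corner 2 2 1)))) (corner 3 0 0))) (split 3 0 (split 3 2 (corner 2 1 0) (corner 1 2 1)) (corner 1 2 0)))) (corner 2 0 0))) (split 3 1 (split 3 2 (split 2 1 (corner 1 2 1) (split 2 2 (split 3 3 (corner 1 2 2) (split 3 0 (corner 2 1 0) (split 0 0 (split 4 1 (split 4 2 (corner 1 3 1) done) (split 4 0 (split 4 3 (corner 3 1 0) (corner 2 2 1)) (corner 1 3 0))) (corner 3 0 0)))) (corner 1 1 1))) (split 2 1 (split 4 1 (split 4 2 (corner 1 3 1) done) (split 4 2 done (split 4 3 (split 4 0 (corner 3 1 0) (corner 2 2 0)) (corner 1 3 2)))) (split 2 2 (split 4 1 (split 4 2 (corner 1 3 1) (split 4 3 (split 4 0 (corner 3 1 0) (corner 2 2 0)) (corner 1 3 2))) (split 4 3 (split 4 0 (corner 3 1 0) (split 3 0 (split 4 2 done (corner 2 2 0)) (corner 1 3 0))) (corner 2 2 1))) (corner 1 1 1)))) (split 3 0 (split 3 2 (corner 2 1 0) (split 2 1 (split 3 3 (split 0 0 (corner 3 0 0) (split 2 2 (split 4 1 (split 4 0 (corner 1 3 0) (split 4 2 done (corner 2 2 0))) (split 4 2 done (corner 1 3 1))) (corner 2 0 0))) (corner 2 1 1)) (corner 1 2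 1))) (corner 1 2 0))))) (split 2 0 (split 1 1 (split 3 1 (split 3 0 (corner 1 2 0) (split 3 2 (split 2 1 (corner 1 2 1) (split 3 3 (corner 2 1 1) (split 0 0 (split 2 2 (corner 2 0 0) (split 4 1 (split 4 2 (corner 1 3 1) done) (split 4 0 (split 4 2 (corner 2 2 0) done) (corner 1 3 0)))) (corner 3 0 0)))) (corner 2 1 0))) (split 3 2 (split 2 1 (split 2 2 (corner 1 1 1) (split 4 1 (split 4 3 (corner 2 2 1) (split 4 0 (split 3 0 (corner 1 3 0) (split 4 2 (corner 2 2 0) done)) (corner 3 1 0))) (split 4 2 (split 4 3 (corner 1 3 2) (split 4 0 (corner 2 2 0) (corner 3 1 0))) (corner 1 3 1)))) (split 4 1 (split 4 2 (split 4 3 (corner 1 3 2) (split 4 0 (corner 2 2 0) (corner 3 1 0))) done) (split 4 2 done (corner 1 3 1)))) (split 2 1 (split 2 2 (corner 1 1 1) (split 3 3 (split 3 0 (split 0 0 (corner 3 0 0) (split 4 1 (split 4 0 (corner 1 3 0) (split 4 3 (corner 2 2 1) (corner 3 1 0))) (split 4 2 done (corner 1 3 1)))) (corner 2 1 0)) (corner 1 2 2))) (corner 1 2 1)))) (split 0 0 (split 2 2 (corner 2 0 0) (split 2 1 (split 3 1 (split 3 0 (corner 1 2 0) (split 3 2 (corner 1 2 1) (corner 2 1 0))) (split 3 3 (split 3 0 (corner 3 0 0) (split 3 2 (split 4 1 (split 4 3 (corner 2 2 1) (split 4 0 (split 4 2 (corner 2 2 0) done) (corner 3 1 0))) (split 4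 0 (split 4 2 (corner 2 2 0) (corner 1 3 1)) (corner 1 3 0))) (corner 2 1 0))) (corner 2 1 1))) (corner 1 1 1))) (corner 1 0 0))) (split 2 1 (split 1 1 (split 2 2 (corner 1 1 1) (split 0 0 (split 3 1 (split 3 2 (corner 1 2 1) (split 3 3 (corner 2 1 1) (corner 1 2 2))) (split 3 0 (split 3 3 (corner 3 0 0) (split 3 2 (split 4 1 (split 4 0 (corner 1 3 0) (split 4 2 done (corner 2 2 0))) (split 4 2 done (corner 1 3 1))) (corner 1 2 2))) (corner 1 2 0))) (corner 2 0 0))) (split 0 0 (split 3 1 (split 3 2 (corner 1 2 1) (split 3 0 (split 3 3 (corner 3 0 0) (split 2 2 (split 4 1 (split 4 0 (corner 1 3 0) (split 4 2 (corner 1 3 1) (corner 2 2 0))) (split 4 2 done done)) (corner 1 2 2))) (corner 2 1 0))) (split 3 0 (split 3 3 (corner 3 0 0) (corner 2 1 1)) (corner 1 2 0))) (corner 1 0 0))) (corner 1 1 0))))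

transition-forced : ∀ {ρ} → CornerFree ρ 3 4 → Transition (map ρ stateCells) (map ρ (map rightOf stateCells))
transition-forced =
  Certified.certified 3 4 transition? stateCells (map rightOf stateCells) stepCertificate _

reachable-start : ∀ {ρ} → CornerFree ρ 3 3 → Reachable (map ρ startCells) 0 (map ρ stateCells)
reachable-start =
  Certified.certified 3 3 (λ i s → reachable? i 0 s) startCells stateCells baseCertificate _

unreachable-end : ∀ {ρ} → CornerFree ρ 4 3 → ¬ Reachable (map ρ startCells) 0 (map ρ (map below stateCells))
unreachable-end =
  Certified.certified 4 3 (λ i s → ¬? (reachable? i 0 s)) startCells (map below stateCells) endCertificate _

module UpperBound (L : ℕ) (4∣L : 4 ∣ L) (c : Coloring) (noCopy : ¬ MonoCopy (4 * L + 4) L 1 c) where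

  window : ℕ → Cell → Bool
  window x (k , j) = c (x + k * L + j)

  window-cornerFree : ∀ {x K J} → 1 ≤ x → x + K * L + J ≤ 4 * L + 4 → CornerFree (window x) K J
  window-cornerFree {x} {K} {J} 1≤x fits {y} {k} {j} 1≤y k+y≤K j+y≤J (same₁ , same₂) =
    noCopy (p , y , ≤-trans 1≤x (≤-trans (m≤m+n x (k * L)) (m≤m+n _ j)) , 1≤y , p-fits ,
            trans same₁ (cong c (down x k j y L)) , trans same₂ (cong c (diagonal x k j y L)))
    where
    p : ℕ
    p = x + k * L + j
    down : ∀ x k j y L → x + (k + y) * L + j ≡ x + k * L + j + y * L
    down = solve-∀
    diagonal : ∀ x k j y L → x + (k + y) * L + (j + y) ≡ x + k * L + j + y * L + y * 1
    diagonal = solve-∀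
    p-fits : p + y * L + y * 1 ≤ 4 * L + 4
    p-fits = subst (_≤ 4 * L + 4) (diagonal x k j y L)
               (≤-trans (+-mono-≤ (+-mono-≤ (≤-refl {x}) (*-monoˡ-≤ L k+y≤K)) j+y≤J) fits)

  window-rightOf : ∀ x v → window x (rightOf v) ≡ window (suc x) v
  window-rightOf x (k , j) = cong c (identity x k j L)
    where identity : ∀ x k j L → x + k * L + suc j ≡ suc x + k * L + j
          identity = solve-∀

  window-below : ∀ x v → window x (below v) ≡ window (x + L) v
  window-below x (k , j) = cong c (identity x k j L)
    where identity : ∀ x k j L → x + suc k * L + j ≡ x + L + k * L + j
          identity = solve-∀

  state : ℕ → List Bool
  state x = map (window x) stateCells

  start : List Bool
  start = map (window 1) startCells

  step : ∀ {x} → 1 ≤ x → x ≤ L → Transition (state x) (state (suc x))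
  step {x} 1≤x x≤L =
    subst (Transition (state x)) (map-∘-≗ {f = window x} {g = rightOf} (window-rightOf x) stateCells)
      (transition-forced {window x} (window-cornerFree 1≤x fits))
    where
    fits : x + 3 * L + 4 ≤ 4 * L + 4
    fits = subst (x + 3 * L + 4 ≤_) (identity L) (+-monoˡ-≤ 4 (+-monoˡ-≤ (3 * L) x≤L))
      where identity : ∀ L → L + 3 * L + 4 ≡ 4 * L + 4
            identity = solve-∀

  reachableAt : ∀ t → t ≤ L → Reachable start (t % 4) (state (suc t))
  reachableAt zero _ = reachable-start {window 1} (window-cornerFree (s≤s z≤n) fits)
    where
    fits : 1 + 3 * L + 3 ≤ 4 * L + 4
    fits = subst₂ _≤_ (identity₁ L) (identity₂ L) (m≤n+m (3 * L + 4) L)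
      where identity₁ : ∀ L → 3 * L + 4 ≡ 1 + 3 * L + 3
            identity₁ = solve-∀
            identity₂ : ∀ L → L + (3 * L + 4) ≡ 4 * L + 4
            identity₂ = solve-∀
  reachableAt (suc t) 1+t≤L =
    subst (λ p → Reachable start p (state (2 + t))) (sym (%-distribˡ-+ 1 t 4))
      (reachable-step (reachableAt t (≤-trans (n≤1+n t) 1+t≤L)) (step (s≤s z≤n) 1+t≤L))

  unreachableAtEnd : ¬ Reachable start 0 (state (suc L))
  unreachableAtEnd =
    subst (λ s → ¬ Reachable start 0 s) (map-∘-≗ {f = window 1} {g = below} (window-below 1) stateCells)
      (unreachable-end {window 1} (window-cornerFree (s≤s z≤n) fits))
    where
    fits : 1 + 4 * L + 3 ≤ 4 * L + 4
    fits = ≤-reflexive (identity L)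
      where identity : ∀ L → 1 + 4 * L + 3 ≡ 4 * L + 4
            identity = solve-∀

  impossible : ⊥
  impossible = unreachableAtEnd (subst (λ p → Reachable start p (state (suc L))) L%4≡0 (reachableAt L ≤-refl))
    where
    L%4≡0 : L % 4 ≡ 0
    L%4≡0 = n∣m⇒m%n≡0 L 4 4∣L

upperBound : ∀ L → 4 ∣ L → Arrows (4 * L + 4) L 1
upperBound L 4∣L c = decidable-stable (monoCopy? (4 * L + 4) L 1 c) (UpperBound.impossible L 4∣L c)

-- Lower bound

xor-cancelʳ : ∀ o {a b} → a xor o ≡ b xor o → a ≡ b
xor-cancelʳ o {a} {b} eq = trans (sym (cancel a)) (trans (cong (_xor o) eq) (cancel b))
  where
  cancel : ∀ x → (x xor o) xor o ≡ x
  cancel x = trans (xor-assoc x o o) (trans (cong (x xor_) (xor-same o)) (xor-identityʳ x))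

Monochromatic-xor : ∀ o {a b c} → Monochromatic (a xor o) (b xor o) (c xor o) → Monochromatic a b c
Monochromatic-xor o (ab , ac) = xor-cancelʳ o ab , xor-cancelʳ o ac

Monochromatic-cong : ∀ {a b c a′ b′ c′} → a ≡ a′ → b ≡ b′ → c ≡ c′ →
                     Monochromatic a b c → Monochromatic a′ b′ c′
Monochromatic-cong refl refl refl mono = mono

notAllEqual : Bool → Bool → Bool → Bool
notAllEqual a b c = (a xor b) ∨ (a xor c)

notAllEqual-sound : ∀ {a b c} → T (notAllEqual a b c) → ¬ Monochromatic a b c
notAllEqual-sound {a} ok (refl , refl) rewrite xor-same a = ok

notAllEqual-twisted : ∀ {a b c} o {a′ b′ c′} → T (notAllEqual a b c) →
                      a′ ≡ a xor o → b′ ≡ b xor o → c′ ≡ c xor o → ¬ Monochromatic a′ b′ c′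
notAllEqual-twisted {a} {b} {c} o ok refl refl refl = notAllEqual-sound {a} {b} {c} ok ∘ Monochromatic-xor o

parity : ℕ → Bool
parity 0 = false
parity 1 = true
parity (suc (suc n)) = parity n

parity-suc : ∀ n → parity (suc n) ≡ not (parity n)
parity-suc 0 = refl
parity-suc 1 = refl
parity-suc (suc (suc n)) = parity-suc n

parity-+ : ∀ m n → parity (m + n) ≡ parity m xor parity n
parity-+ 0 n = refl
parity-+ 1 n = parity-suc n
parity-+ (suc (suc m)) n = parity-+ m n

parity-double : ∀ n → parity (n + n) ≡ false
parity-double n = trans (parity-+ n n) (xor-same (parity n))

-- Row q of a column with e columns to its right and r to its left, before the parity twist.
rowPattern : ℕ → ℕ → ℕ → Bool
rowPattern 0 e _ = 2 ≤ᵇ e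
rowPattern 1 e _ = 1 ≤ᵇ e
rowPattern 2 e _ = e <ᵇ 2
rowPattern 3 e _ = e <ᵇ 1
rowPattern _ _ r = r ≡ᵇ 0

-- For r < L, cell (r , q) lies in [1, 4L + 3] (position 1 + r + q L).
inRange : ℕ → ℕ → Bool
inRange r q = (q ≤ᵇ 3) ∨ ((q ≡ᵇ 4) ∧ (r ≤ᵇ 2))

-- The corner (r , q), (r , y + q), (y + r , y + q), whose last column has e columns to its right.
unwrapped-notAllEqual : ∀ y q e r → T (1 ≤ᵇ y) → T (inRange (y + r) (y + q)) →
  T (notAllEqual (rowPattern q (y + e) r) (rowPattern (y + q) (y + e) r)
                 (rowPattern (y + q) e (y + r) xor parity y))
unwrapped-notAllEqual 0 q e r () _
unwrapped-notAllEqual 1 0 0 r _ _ = _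
unwrapped-notAllEqual 1 0 1 r _ _ = _
unwrapped-notAllEqual 1 0 (suc (suc e)) r _ _ = _
unwrapped-notAllEqual 1 1 0 r _ _ = _
unwrapped-notAllEqual 1 1 1 r _ _ = _
unwrapped-notAllEqual 1 1 (suc (suc e)) r _ _ = _
unwrapped-notAllEqual 1 2 0 r _ _ = _
unwrapped-notAllEqual 1 2 1 r _ _ = _
unwrapped-notAllEqual 1 2 (suc (suc e)) r _ _ = _
unwrapped-notAllEqual 1 3 e 0 _ _ = _
unwrapped-notAllEqual 1 3 e 1 _ _ = _
unwrapped-notAllEqual 1 3 e (suc (suc r)) _ ()
unwrapped-notAllEqual 1 4 e r _ ()
unwrapped-notAllEqual 1 (suc (suc (suc (suc (suc q))))) e r _ ()
unwrapped-notAllEqual 2 0 e r _ _ = _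
unwrapped-notAllEqual 2 1 e r _ _ = _
unwrapped-notAllEqual 2 2 e 0 _ _ = _
unwrapped-notAllEqual 2 2 e (suc r) _ ()
unwrapped-notAllEqual 2 3 e r _ ()
unwrapped-notAllEqual 2 4 e r _ ()
unwrapped-notAllEqual 2 (suc (suc (suc (suc (suc q))))) e r _ ()
unwrapped-notAllEqual 3 0 e r _ _ = _
unwrapped-notAllEqual 3 1 e r _ ()
unwrapped-notAllEqual 3 2 e r _ ()
unwrapped-notAllEqual 3 3 e r _ ()
unwrapped-notAllEqual 3 4 e r _ ()
unwrapped-notAllEqual 3 (suc (suc (suc (suc (suc q))))) e r _ ()
unwrapped-notAllEqual 4 0 e r _ ()
unwrapped-notAllEqual 4 1 e r _ ()
unwrapped-notAllEqual 4 2 e r _ ()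
unwrapped-notAllEqual 4 3 e r _ ()
unwrapped-notAllEqual 4 4 e r _ ()
unwrapped-notAllEqual 4 (suc (suc (suc (suc (suc q))))) e r _ ()
unwrapped-notAllEqual (suc (suc (suc (suc (suc y))))) q e r _ ()

-- The corner (r , q), (r , y + q), (r′ , 1 + y + q) wrapping past the right edge: column r has e
-- columns to its right, so y = 1 + e + r′, and column r′ has e″ columns to its right.
wrapped-notAllEqual : ∀ e r′ q e″ r →
  T (inRange r′ (suc (suc (e + r′) + q))) → T (4 ≤ᵇ r′ + suc e″) →
  T (notAllEqual (rowPattern q e r) (rowPattern (suc (e + r′) + q) e r)
                 (rowPattern (suc (suc (e + r′) + q)) e″ r′ xor parity (suc (e + r′))))
wrapped-notAllEqual e 0 q 0 r _ ()
wrapped-notAllEqual e 0 q 1 r _ ()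
wrapped-notAllEqual e 1 q 0 r _ ()
wrapped-notAllEqual e 1 q 1 r _ ()
wrapped-notAllEqual e 2 q 0 r _ ()
wrapped-notAllEqual 0 0 0 (suc (suc e″)) r _ _ = _
wrapped-notAllEqual 0 0 1 e″ r _ _ = _
wrapped-notAllEqual 0 0 2 e″ r _ _ = _
wrapped-notAllEqual 0 0 3 e″ r () _
wrapped-notAllEqual 0 0 (suc (suc (suc (suc q)))) e″ r () _
wrapped-notAllEqual 0 1 0 e″ r _ _ = _
wrapped-notAllEqual 0 1 1 e″ r _ _ = _
wrapped-notAllEqual 0 1 2 e″ r () _
wrapped-notAllEqual 0 1 3 e″ r () _
wrapped-notAllEqual 0 1 (suc (suc (suc (suc q)))) e″ r () _
wrapped-notAllEqual 0 2 0 e″ r _ _ = _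
wrapped-notAllEqual 0 2 1 e″ r () _
wrapped-notAllEqual 0 2 2 e″ r () _
wrapped-notAllEqual 0 2 3 e″ r () _
wrapped-notAllEqual 0 2 (suc (suc (suc (suc q)))) e″ r () _
wrapped-notAllEqual 0 (suc (suc (suc r′))) q e″ r () _
wrapped-notAllEqual 1 0 0 e″ r _ _ = _
wrapped-notAllEqual 1 0 1 e″ r _ _ = _
wrapped-notAllEqual 1 0 2 e″ r () _
wrapped-notAllEqual 1 0 3 e″ r () _
wrapped-notAllEqual 1 0 (suc (suc (suc (suc q)))) e″ r () _
wrapped-notAllEqual 1 1 0 e″ r _ _ = _
wrapped-notAllEqual 1 1 1 e″ r () _
wrapped-notAllEqual 1 1 2 e″ r () _
wrapped-notAllEqual 1 1 3 e″ r () _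
wrapped-notAllEqual 1 1 (suc (suc (suc (suc q)))) e″ r () _
wrapped-notAllEqual 1 2 q e″ r () _
wrapped-notAllEqual 1 (suc (suc (suc r′))) q e″ r () _
wrapped-notAllEqual 2 0 0 e″ r _ _ = _
wrapped-notAllEqual 2 0 1 e″ r () _
wrapped-notAllEqual 2 0 2 e″ r () _
wrapped-notAllEqual 2 0 3 e″ r () _
wrapped-notAllEqual 2 0 (suc (suc (suc (suc q)))) e″ r () _
wrapped-notAllEqual 2 1 q e″ r () _
wrapped-notAllEqual 2 2 q e″ r () _
wrapped-notAllEqual 2 (suc (suc (suc r′))) q e″ r () _
wrapped-notAllEqual (suc (suc (suc e))) r′ q e″ r () _

module LowerBound (L : ℕ) (4≤L : 4 ≤ L) (L-even : parity L ≡ false) where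

  private instance
    L-nonZero : NonZero L
    L-nonZero = >-nonZero (≤-trans (s≤s z≤n) 4≤L)

  cellColour : ℕ → ℕ → Bool
  cellColour r q = rowPattern q (L ∸ suc r) r xor parity r

  colouring : Coloring
  colouring p = cellColour ((p ∸ 1) % L) ((p ∸ 1) / L)

  colouring-cell : ∀ {r} q → r < L → colouring (suc (r + q * L)) ≡ cellColour r q
  colouring-cell {r} q r<L = cong₂ cellColour remainder quotient
    where
    remainder : (r + q * L) % L ≡ r
    remainder = trans ([m+kn]%n≡m%n r q L) (m<n⇒m%n≡m r<L)
    quotient : (r + q * L) / L ≡ q
    quotient = trans (+-distrib-/-∣ʳ r (n∣m*n q)) (cong₂ _+_ (m<n⇒m/n≡0 r<L) (m*n/n≡m q L))

  margin : ∀ {r} → r < L → ∃[ e ] suc (r + e) ≡ L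
  margin {r} r<L = L ∸ suc r , m+[n∸m]≡n r<L

  cellColour-margin : ∀ {r e} q → suc (r + e) ≡ L → cellColour r q ≡ rowPattern q e r xor parity r
  cellColour-margin {r} {e} q r+e+1≡L = cong (λ e′ → rowPattern q e′ r xor parity r) L-r-1≡e
    where
    L-r-1≡e : L ∸ suc r ≡ e
    L-r-1≡e = trans (cong (_∸ suc r) (sym r+e+1≡L)) (m+n∸m≡n (suc r) e)

  cellColour-twisted : ∀ {r′ e} q r y → suc (r′ + e) ≡ L → parity r′ ≡ parity y xor parity r →
                       cellColour r′ q ≡ (rowPattern q e r′ xor parity y) xor parity r
  cellColour-twisted {r′} {e} q r y r′+e+1≡L parity-r′ = begin
    cellColour r′ q                                ≡⟨ cellColour-margin q r′+e+1≡L ⟩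
    rowPattern q e r′ xor parity r′                ≡⟨ cong (rowPattern q e r′ xor_) parity-r′ ⟩
    rowPattern q e r′ xor (parity y xor parity r)  ≡⟨ xor-assoc (rowPattern q e r′) (parity y) (parity r) ⟨
    (rowPattern q e r′ xor parity y) xor parity r  ∎

  row-bound : ∀ a k → a + k * L ≤ 4 * L + 3 → k ≤ 4
  row-bound a k fits = ≤-pred (*-cancelʳ-< L k 5 (≤-<-trans (m+n≤o⇒n≤o a fits) 4L+3<5L))
    where
    4L+3<5L : 4 * L + 3 < 5 * L
    4L+3<5L = subst (4 * L + 3 <_) (+-comm (4 * L) L) (+-monoʳ-< (4 * L) 4≤L)

  inRange-sound : ∀ r q → suc (r + q * L) ≤ 4 * L + 3 → T (inRange r q)
  inRange-sound r q fits with m≤n⇒m<n∨m≡n (row-bound (suc r) q fits)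
  ... | inj₁ q<4 = Equivalence.from (T-∨ {q ≤ᵇ 3}) (inj₁ (≤⇒≤ᵇ (≤-pred q<4)))
  ... | inj₂ refl = ≤⇒≤ᵇ (≤-pred (+-cancelʳ-≤ (4 * L) (suc r) 3 r+4L≤3+4L))
    where
    r+4L≤3+4L : suc r + 4 * L ≤ 3 + 4 * L
    r+4L≤3+4L = subst (suc r + 4 * L ≤_) (+-comm (4 * L) 3) fits

  unwrappedCorner-free : ∀ {r q y e} → 1 ≤ y → suc (y + r + e) ≡ L →
                         suc (y + r + (y + q) * L) ≤ 4 * L + 3 →
                         ¬ Monochromatic (cellColour r q) (cellColour r (y + q)) (cellColour (y + r) (y + q))
  unwrappedCorner-free {r} {q} {y} {e} 1≤y y+r+e+1≡L fits =
    notAllEqual-twisted {a} {b} {c} (parity r)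
      (unwrapped-notAllEqual y q e r (≤⇒≤ᵇ 1≤y) (inRange-sound (y + r) (y + q) fits))
      (cellColour-margin q r+e+1≡L) (cellColour-margin (y + q) r+e+1≡L)
      (cellColour-twisted (y + q) r y y+r+e+1≡L (parity-+ y r))
    where
    a : Bool
    a = rowPattern q (y + e) r
    b : Bool
    b = rowPattern (y + q) (y + e) r
    c : Bool
    c = rowPattern (y + q) e (y + r) xor parity y
    r+e+1≡L : suc (r + (y + e)) ≡ L
    r+e+1≡L = trans (cong suc (identity r y e)) y+r+e+1≡L
      where identity : ∀ r y e → r + (y + e) ≡ y + r + e
            identity = solve-∀

  wrappedCorner-free : ∀ {r q y e r′ e″} → y ≡ suc (e + r′) → suc (r + e) ≡ L → suc (r′ + e″) ≡ L →
                       suc (r′ + suc (y + q) * L) ≤ 4 * L + 3 →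
                       ¬ Monochromatic (cellColour r q) (cellColour r (y + q)) (cellColour r′ (suc (y + q)))
  wrappedCorner-free {r} {q} {e = e} {r′} {e″} refl r+e+1≡L r′+e″+1≡L fits =
    notAllEqual-twisted {a} {b} {c} (parity r)
      (wrapped-notAllEqual e r′ q e″ r (inRange-sound r′ (suc (y + q)) fits) (≤⇒≤ᵇ 4≤r′+e″+1))
      (cellColour-margin q r+e+1≡L) (cellColour-margin (y + q) r+e+1≡L)
      (cellColour-twisted (suc (y + q)) r y r′+e″+1≡L parity-r′)
    where
    y : ℕ
    y = suc (e + r′)
    a : Bool
    a = rowPattern q e r
    b : Bool
    b = rowPattern (y + q) e r
    c : Bool
    c = rowPattern (suc (y + q)) e″ r′ xor parity y
    4≤r′+e″+1 : 4 ≤ r′ + suc e″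
    4≤r′+e″+1 = subst (4 ≤_) (trans (sym r′+e″+1≡L) (sym (+-suc r′ e″))) 4≤L
    parity-r′ : parity r′ ≡ parity y xor parity r
    parity-r′ = begin
      parity r′                ≡⟨ cong (_xor parity r′) L-even ⟨
      parity L xor parity r′   ≡⟨ parity-+ L r′ ⟨
      parity (L + r′)          ≡⟨ cong (λ n → parity (n + r′)) r+e+1≡L ⟨
      parity (suc (r + e) + r′) ≡⟨ cong parity (identity r e r′) ⟩
      parity (y + r)           ≡⟨ parity-+ y r ⟩
      parity y xor parity r    ∎
      where identity : ∀ r e r′ → suc (r + e) + r′ ≡ suc (e + r′) + r
            identity = solve-∀

  cell-cornerFree : ∀ {r q y} → r < L → 1 ≤ y → suc (y + r + (y + q) * L) ≤ 4 * L + 3 →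
                    ¬ Monochromatic (cellColour r q) (cellColour r (y + q))
                                    (colouring (suc (y + r + (y + q) * L)))
  cell-cornerFree {r} {q} {y} r<L 1≤y fits with y + r <? L
  ... | yes y+r<L = unwrappedCorner-free 1≤y (proj₂ (margin y+r<L)) fits
                    ∘ Monochromatic-cong refl refl (colouring-cell (y + q) y+r<L)
  ... | no y+r≮L = wrappedCorner-free y≡1+e+r′ (proj₂ (margin r<L)) (proj₂ (margin r′<L)) fits′
                   ∘ Monochromatic-cong refl refl (trans (cong colouring wrap) (colouring-cell (suc (y + q)) r′<L))
    where
    r′ : ℕ
    r′ = y + r ∸ L
    L+r′≡y+r : L + r′ ≡ y + r
    L+r′≡y+r = m+[n∸m]≡n (≮⇒≥ y+r≮L)
    e : ℕ
    e = proj₁ (margin r<L)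
    y≡1+e+r′ : y ≡ suc (e + r′)
    y≡1+e+r′ = +-cancelʳ-≡ r y (suc (e + r′)) (begin
      y + r               ≡⟨ L+r′≡y+r ⟨
      L + r′              ≡⟨ cong (_+ r′) (proj₂ (margin r<L)) ⟨
      suc (r + e) + r′    ≡⟨ identity r e r′ ⟩
      suc (e + r′) + r    ∎)
      where identity : ∀ r e r′ → suc (r + e) + r′ ≡ suc (e + r′) + r
            identity = solve-∀
    wrap : suc (y + r + (y + q) * L) ≡ suc (r′ + suc (y + q) * L)
    wrap = trans (cong (λ n → suc (n + (y + q) * L)) (sym L+r′≡y+r)) (identity L r′ (y + q))
      where identity : ∀ L r′ k → suc (L + r′ + k * L) ≡ suc (r′ + suc k * L)
            identity = solve-∀
    fits′ : suc (r′ + suc (y + q) * L) ≤ 4 * L + 3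
    fits′ = subst (_≤ 4 * L + 3) wrap fits
    y≤L : y ≤ L
    y≤L = ≤-trans (≤-trans (m≤m+n y q) (row-bound (suc (y + r)) (y + q) fits)) 4≤L
    r′<L : r′ < L
    r′<L = ≤-<-trans (+-cancelˡ-≤ L r′ r (subst (_≤ L + r) (sym L+r′≡y+r) (+-monoˡ-≤ r y≤L))) r<L

  colouring-cornerFree : ∀ {x y} → 1 ≤ x → 1 ≤ y → x + y * L + y * 1 ≤ 4 * L + 3 →
                         ¬ Monochromatic (colouring x) (colouring (x + y * L)) (colouring (x + y * L + y * 1))
  colouring-cornerFree {suc s} {y} _ 1≤y fits =
    cell-cornerFree (m%n<n s L) 1≤y (subst (_≤ 4 * L + 3) third fits)
    ∘ Monochromatic-cong refl (trans (cong colouring second) (colouring-cell (y + q) (m%n<n s L)))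
                         (cong colouring third)
    where
    r : ℕ
    r = s % L
    q : ℕ
    q = s / L
    s≡r+qL : s ≡ r + q * L
    s≡r+qL = m≡m%n+[m/n]*n s L
    second : suc s + y * L ≡ suc (r + (y + q) * L)
    second = trans (cong (λ n → suc n + y * L) s≡r+qL) (identity r q y L)
      where identity : ∀ r q y L → suc (r + q * L) + y * L ≡ suc (r + (y + q) * L)
            identity = solve-∀
    third : suc s + y * L + y * 1 ≡ suc (y + r + (y + q) * L)
    third = trans (cong (λ n → suc n + y * L + y * 1) s≡r+qL) (identity r q y L)
      where identity : ∀ r q y L → suc (r + q * L) + y * L + y * 1 ≡ suc (y + r + (y + q) * L)
            identity = solve-∀

lowerBound : ∀ L → 4 ≤ L → parity L ≡ false → ¬ Arrows (4 * L + 3) L 1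
lowerBound L 4≤L L-even arrows with arrows (LowerBound.colouring L 4≤L L-even)
... | _ , _ , 1≤x , 1≤y , fits , mono = LowerBound.colouring-cornerFree L 4≤L L-even 1≤x 1≤y fits mono

mainTheorem3 : (m : ℕ) → 1 ≤ m → IsF (4 * m) 1 (16 * m + 4)
mainTheorem3 m 1≤m = ≤-trans (s≤s z≤n) (m≤n+m 4 (16 * m)) , arrows , minimal
  where
  L : ℕ
  L = 4 * m
  16m+4≡4L+4 : ∀ m → 16 * m + 4 ≡ 4 * (4 * m) + 4
  16m+4≡4L+4 = solve-∀
  arrows : Arrows (16 * m + 4) L 1
  arrows = subst (λ N → Arrows N L 1) (sym (16m+4≡4L+4 m)) (upperBound L (m∣m*n m))
  L-even : parity L ≡ false
  L-even = trans (cong parity (identity m)) (parity-double (2 * m))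
    where identity : ∀ m → 4 * m ≡ 2 * m + 2 * m
          identity = solve-∀
  minimal : ∀ M → 1 ≤ M → M < 16 * m + 4 → ¬ Arrows M L 1
  minimal M _ M<N = lowerBound L (*-monoʳ-≤ 4 1≤m) L-even ∘ Arrows-mono M≤4L+3
    where
    M≤4L+3 : M ≤ 4 * L + 3
    M≤4L+3 = ≤-pred (subst (M <_) (trans (16m+4≡4L+4 m) (+-suc (4 * L) 3)) M<N)
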